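{- For each lattice graph $\Gamma=P_{n_1}\Box\cdots\Box P_{n_d}$, the nim-value of $\text{DNT}(\Gamma)$ equals the parity of $n_1\cdots n_d$, i.e. $(n_1\cdots n_d \bmod 2)$.
   Context: $P_k$ is the path graph on $k$ vertices; a ($d$-dimensional) lattice graph is $P_{n_1}\Box\cdots\Box P_{n_d}$ with $2\le n_1\le\cdots\le n_d$ and $n_d\ge 3$. A vertex set is (geodetically) convex if it contains every vertex on every shortest path between two of its vertices; the convex hull $[S]$ is the smallest convex set containing $S$. In the removing game $\text{DNT}(\Gamma)$ with vertex set $V$, two players alternately select previously unselected vertices; a position is the set $P$ of selected vertices, and a move is legal only if afterwards $[V\setminus P]=V$. The last player to move wins (normal play). The nim-value is the Sprague–Grundy value of the starting position. -}

module Defs where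

open import Data.Nat using (ℕ; zero; suc; _+_; _*_; _≤_; _<_)
open import Data.Fin using (Fin; toℕ)
open import Data.Vec using (Vec; []; _∷_)
open import Data.Product using (_×_; _,_; Σ; ∃; ∃-syntax)
open import Data.Sum using (_⊎_)
open import Data.Unit using (⊤)
open import Data.List using (List; []; _∷_)
open import Data.List.Membership.Propositional using (_∉_)
open import Relation.Binary.PropositionalEquality using (_≡_; _≢_)
open import Level using (Level)

prod : ∀ {d} → Vec ℕ d → ℕ
prod [] = 1
prod (n ∷ ns) = n * prod ns

-- Vertices of P_{n₁} □ ⋯ □ P_{n_d}: tuples (x₁,…,x_d) with x_i ∈ {0,…,n_i - 1}.
Vertex : ∀ {d} → Vec ℕ d → Set
Vertex [] = ⊤
Vertex (n ∷ ns) = Fin n × Vertex ns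

PathAdj : ∀ {n} → Fin n → Fin n → Set
PathAdj a b = (toℕ b ≡ suc (toℕ a)) ⊎ (toℕ a ≡ suc (toℕ b))

Adj : ∀ {d} (ns : Vec ℕ d) → Vertex ns → Vertex ns → Set
Adj [] _ _ = Data.Empty.⊥ where import Data.Empty
Adj (n ∷ ns) (a , xs) (b , ys) = (PathAdj a b × xs ≡ ys) ⊎ (a ≡ b × Adj ns xs ys)

module _ {d} (ns : Vec ℕ d) where

  V : Set
  V = Vertex ns

  data Walk : V → V → Set where
    stop : (x : V) → Walk x x
    step : {x y z : V} → Adj ns x y → Walk y z → Walk x z

  walkLength : ∀ {x y} → Walk x y → ℕ
  walkLength (stop _) = 0
  walkLength (step _ w) = suc (walkLength w)

  data OnWalk (z : V) : ∀ {x y} → Walk x y → Set where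
    here-stop : OnWalk z (stop z)
    here-step : ∀ {y w} {e : Adj ns z y} (p : Walk y w) → OnWalk z (step e p)
    there : ∀ {x y w} {e : Adj ns x y} {p : Walk y w} → OnWalk z p → OnWalk z (step e p)

  Shortest : ∀ {x y} → Walk x y → Set
  Shortest {x} {y} w = (w' : Walk x y) → walkLength w ≤ walkLength w'

  Convex : (V → Set) → Set
  Convex C = (x y : V) → C x → C y → (w : Walk x y) → Shortest w →
             (z : V) → OnWalk z w → C z

  InHull : (V → Set) → V → Set₁
  InHull S v = (C : V → Set) → Convex C → ((u : V) → S u → C u) → C v

  -- A position is the list of selected vertices; [V \ P] = V.
  Generating : List V → Set₁
  Generating P = (v : V) → InHull (λ u → u ∉ P) v

  Move : List V → V → Set₁
  Move P v = (v ∉ P) × Generating (v ∷ P)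

  -- Sprague–Grundy value, as an inductive relation: SG P g holds iff
  -- every option has a SG value and g is the mex of the option values.
  data SG (P : List V) : ℕ → Set₁ where
    sg : (g : ℕ)
         (val : (v : V) → Move P v → ℕ)
         (sub : (v : V) (m : Move P v) → SG (v ∷ P) (val v m))
         (notOpt : (v : V) (m : Move P v) → val v m ≢ g)
         (below : (k : ℕ) → k < g → Σ V λ v → Σ (Move P v) λ m → val v m ≡ k)
         → SG P g

  NimValueDNT : ℕ → Set₁
  NimValueDNT g = SG [] g

-- A vertex set S of the box P_{n₁} □ ⋯ □ P_{n_d} (all n_i ≥ 2) has convex hull the whole box
-- iff S meets each of the 2d facets x_i = 0 and x_i = n_i − 1. The complement of a facet is
-- convex, which gives one direction; for the other, vertices of S on both facets orthogonal to
-- the i-th axis let a convex superset of S change the i-th coordinate of any of its points at will.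
-- The criterion is invariant under the central symmetry σ, x_i ↦ n_i − 1 − x_i, so from a
-- σ-symmetric position, answering a move v ≠ σ v by σ v is always legal. If some n_i is even, σ has no fixed
-- vertex and this mirror strategy makes every symmetric position a P-position: the value is 0.
-- If all n_i are odd, the centre is the unique fixed vertex and lies on no facet: taking it
-- leads to a position of value 0, and any other option v has value ≠ 1 because its mirror reply
-- σ v leads, by induction, to a symmetric position of value 1. Hence the value is 1.
module Submission where

open import Data.Bool.Base using (Bool; false; true; not)
open import Data.Empty using (⊥-elim)
import Data.Fin
open import Data.Fin.Base using (Fin; zero; suc; toℕ; fromℕ; fromℕ<; opposite)
import Data.Fin.Properties as Fin
open import Data.Fin.Properties using (toℕ-injective; toℕ<n; toℕ-fromℕ; toℕ-fromℕ<)
open import Data.List.Base using (List; []; _∷_; allFin; cartesianProduct; map; filter)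
open import Data.List.Extrema.Nat using (max; xs≤max)
open import Data.List.Membership.Propositional using (_∈_; _∉_; lose)
open import Data.List.Membership.Propositional.Properties
  using (∈-allFin; ∈-cartesianProduct⁺; ∈-map⁺; ∈-map∘filter⁻; ∈-filter⁺)
import Data.List.Relation.Unary.All as List
open import Data.List.Relation.Unary.Any using (here; there; any?; satisfied)
import Data.Nat
open import Data.Nat.Base using (ℕ; zero; suc; _+_; _*_; _∸_; _/_; _%_; _≤_; _<_; ∣_-_∣; z≤n; s≤s)
open import Data.Nat.DivMod using (m≡m%n+[m/n]*n; m%n<n; [m+kn]%n≡m%n; %-distribˡ-*)
open import Data.Nat.Induction using (<-wellFounded)
open import Data.Nat.Properties
open import Algebra.Properties.CommutativeSemigroup +-commutativeSemigroup using (interchange; x∙yz≈y∙xz)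
open import Data.Product.Base using (Σ; _×_; _,_; proj₁; proj₂)
open import Data.Product.Properties using (≡-dec)
open import Data.Sum.Base using (_⊎_; inj₁; inj₂)
open import Data.Unit.Base using (tt)
open import Data.Vec.Base using (Vec; []; _∷_; lookup; head; last)
open import Data.Vec.Relation.Unary.All as All using (All; []; _∷_)
open import Data.Vec.Relation.Unary.All.Properties using (lookup⁻)
open import Induction.WellFounded using (Acc; acc)
open import Relation.Binary.Definitions using (DecidableEquality; tri<; tri≈; tri>)
open import Relation.Binary.PropositionalEquality
open import Relation.Nullary using (¬_; Dec; yes; no; _×-dec_; ¬?)
open import Relation.Nullary.Decidable using (map′)
open import Relation.Unary using (Decidable)

open import Defs

variable
  d n : ℕ

-- Distance and geodesics

dist : {ns : Vec ℕ d} → Vertex ns → Vertex ns → ℕ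
dist {ns = []} _ _ = 0
dist {ns = _ ∷ _} (a , xs) (b , ys) = ∣ toℕ a - toℕ b ∣ + dist xs ys

dist-self : {ns : Vec ℕ d} (x : Vertex ns) → dist x x ≡ 0
dist-self {ns = []} _ = refl
dist-self {ns = _ ∷ _} (a , xs) = cong₂ _+_ (∣n-n∣≡0 (toℕ a)) (dist-self xs)

dist-triangle : {ns : Vec ℕ d} (x y z : Vertex ns) → dist x z ≤ dist x y + dist y z
dist-triangle {ns = []} _ _ _ = z≤n
dist-triangle {ns = _ ∷ _} (a , xs) (b , ys) (c , zs) = begin
  ∣ toℕ a - toℕ c ∣ + dist xs zs
    ≤⟨ +-mono-≤ (∣-∣-triangle (toℕ a) (toℕ b) (toℕ c)) (dist-triangle xs ys zs) ⟩
  (∣ toℕ a - toℕ b ∣ + ∣ toℕ b - toℕ c ∣) + (dist xs ys + dist ys zs)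
    ≡⟨ interchange ∣ toℕ a - toℕ b ∣ _ _ _ ⟩
  (∣ toℕ a - toℕ b ∣ + dist xs ys) + (∣ toℕ b - toℕ c ∣ + dist ys zs) ∎
  where open ≤-Reasoning

∣m-1+m∣≡1 : ∀ m → ∣ m - suc m ∣ ≡ 1
∣m-1+m∣≡1 zero = refl
∣m-1+m∣≡1 (suc m) = ∣m-1+m∣≡1 m

pathAdj⇒∣-∣≡1 : {a b : Fin n} → PathAdj a b → ∣ toℕ a - toℕ b ∣ ≡ 1
pathAdj⇒∣-∣≡1 {a = a} (inj₁ b≡1+a) rewrite b≡1+a = ∣m-1+m∣≡1 (toℕ a)
pathAdj⇒∣-∣≡1 {b = b} (inj₂ a≡1+b) rewrite a≡1+b =
  trans (∣-∣-comm (suc (toℕ b)) (toℕ b)) (∣m-1+m∣≡1 (toℕ b))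

adj⇒dist≡1 : {ns : Vec ℕ d} {x y : Vertex ns} → Adj ns x y → dist x y ≡ 1
adj⇒dist≡1 {ns = []} ()
adj⇒dist≡1 {ns = _ ∷ _} {_ , xs} (inj₁ (e , refl)) = cong₂ _+_ (pathAdj⇒∣-∣≡1 e) (dist-self xs)
adj⇒dist≡1 {ns = _ ∷ _} {a , _} (inj₂ (refl , e)) = cong₂ _+_ (∣n-n∣≡0 (toℕ a)) (adj⇒dist≡1 e)

adj-sym : {ns : Vec ℕ d} {x y : Vertex ns} → Adj ns x y → Adj ns y x
adj-sym {ns = []} ()
adj-sym {ns = _ ∷ _} (inj₁ (inj₁ e , xs≡ys)) = inj₁ (inj₂ e , sym xs≡ys)
adj-sym {ns = _ ∷ _} (inj₁ (inj₂ e , xs≡ys)) = inj₁ (inj₁ e , sym xs≡ys)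
adj-sym {ns = _ ∷ _} (inj₂ (a≡b , e)) = inj₂ (sym a≡b , adj-sym e)

dist-adj-≤ : {ns : Vec ℕ d} {x y : Vertex ns} → Adj ns x y → (z : Vertex ns) → dist x z ≤ suc (dist y z)
dist-adj-≤ {x = x} {y} e z = ≤-trans (dist-triangle x y z) (≤-reflexive (cong (_+ dist y z) (adj⇒dist≡1 e)))

dist≤length : {ns : Vec ℕ d} {x y : Vertex ns} (w : Walk ns x y) → dist x y ≤ walkLength ns w
dist≤length (stop x) = ≤-reflexive (dist-self x)
dist≤length {y = y} (step e w) = ≤-trans (dist-adj-≤ e y) (s≤s (dist≤length w))

onWalk⇒dist≤length : {ns : Vec ℕ d} {x y z : Vertex ns} {w : Walk ns x y} →
                     OnWalk ns z w → dist x z + dist z y ≤ walkLength ns w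
onWalk⇒dist≤length {z = z} here-stop = ≤-reflexive (cong₂ _+_ (dist-self z) (dist-self z))
onWalk⇒dist≤length {y = y} {z} (here-step {e = e} w) rewrite dist-self z =
  ≤-trans (dist-adj-≤ e y) (s≤s (dist≤length w))
onWalk⇒dist≤length {y = y} {z} (there {e = e} z∈w) =
  ≤-trans (+-monoˡ-≤ (dist z y) (dist-adj-≤ e z)) (s≤s (onWalk⇒dist≤length z∈w))

infixr 5 _++ʷ_

_++ʷ_ : {ns : Vec ℕ d} {x y z : Vertex ns} → Walk ns x y → Walk ns y z → Walk ns x z
stop _ ++ʷ w = w
step e v ++ʷ w = step e (v ++ʷ w)

length-++ʷ : {ns : Vec ℕ d} {x y z : Vertex ns} (v : Walk ns x y) (w : Walk ns y z) →
             walkLength ns (v ++ʷ w) ≡ walkLength ns v + walkLength ns w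
length-++ʷ (stop _) w = refl
length-++ʷ (step e v) w = cong suc (length-++ʷ v w)

onWalk-++ʷ : {ns : Vec ℕ d} {x y z : Vertex ns} (v : Walk ns x z) (w : Walk ns z y) → OnWalk ns z (v ++ʷ w)
onWalk-++ʷ (step e v) w = there (onWalk-++ʷ v w)
onWalk-++ʷ (stop _) (stop _) = here-stop
onWalk-++ʷ (stop _) (step e w) = here-step w

reverseʷ : {ns : Vec ℕ d} {x y : Vertex ns} → Walk ns x y → Walk ns y x
reverseʷ (stop x) = stop x
reverseʷ {x = x} (step e w) = reverseʷ w ++ʷ step (adj-sym e) (stop x)

length-reverseʷ : {ns : Vec ℕ d} {x y : Vertex ns} (w : Walk ns x y) →
                  walkLength ns (reverseʷ w) ≡ walkLength ns w
length-reverseʷ (stop x) = refl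
length-reverseʷ {x = x} (step e w) = begin
  walkLength _ (reverseʷ w ++ʷ step (adj-sym e) (stop x)) ≡⟨ length-++ʷ (reverseʷ w) _ ⟩
  walkLength _ (reverseʷ w) + 1                          ≡⟨ +-comm _ 1 ⟩
  suc (walkLength _ (reverseʷ w))                        ≡⟨ cong suc (length-reverseʷ w) ⟩
  suc (walkLength _ w)                                   ∎
  where open ≡-Reasoning

liftʷ : {ns : Vec ℕ d} {xs ys : Vertex ns} (a : Fin n) → Walk ns xs ys → Walk (n ∷ ns) (a , xs) (a , ys)
liftʷ a (stop xs) = stop (a , xs)
liftʷ a (step e w) = step (inj₂ (refl , e)) (liftʷ a w)

length-liftʷ : {ns : Vec ℕ d} {xs ys : Vertex ns} (a : Fin n) (w : Walk ns xs ys) →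
               walkLength (n ∷ ns) (liftʷ a w) ≡ walkLength ns w
length-liftʷ a (stop _) = refl
length-liftʷ a (step e w) = cong suc (length-liftʷ a w)

ascentʷ : {ns : Vec ℕ d} (xs : Vertex ns) (k : ℕ) (a b : Fin n) → toℕ b ≡ k + toℕ a →
          Walk (n ∷ ns) (a , xs) (b , xs)
ascentʷ xs zero a b b≡a with toℕ-injective b≡a
... | refl = stop (a , xs)
ascentʷ {n = n} xs (suc k) a b b≡1+k+a =
  step (inj₁ (inj₁ (toℕ-fromℕ< 1+a<n) , refl)) (ascentʷ xs k (fromℕ< 1+a<n) b b≡k+1+a)
  where
  1+a<n : suc (toℕ a) < n
  1+a<n = ≤-<-trans (≤-trans (s≤s (m≤n+m (toℕ a) k)) (≤-reflexive (sym b≡1+k+a))) (toℕ<n b)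
  b≡k+1+a : toℕ b ≡ k + toℕ (fromℕ< 1+a<n)
  b≡k+1+a = trans b≡1+k+a (trans (sym (+-suc k (toℕ a))) (cong (k +_) (sym (toℕ-fromℕ< 1+a<n))))

length-ascentʷ : {ns : Vec ℕ d} (xs : Vertex ns) (k : ℕ) (a b : Fin n) (b≡k+a : toℕ b ≡ k + toℕ a) →
                 walkLength (n ∷ ns) (ascentʷ xs k a b b≡k+a) ≡ k
length-ascentʷ xs zero a b b≡a with toℕ-injective b≡a
... | refl = refl
length-ascentʷ xs (suc k) a b _ = cong suc (length-ascentʷ xs k _ b _)

segmentʷ : {ns : Vec ℕ d} (xs : Vertex ns) (a b : Fin n) → Walk (n ∷ ns) (a , xs) (b , xs)
segmentʷ xs a b with ≤-total (toℕ a) (toℕ b)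
... | inj₁ a≤b = ascentʷ xs (toℕ b ∸ toℕ a) a b (sym (m∸n+n≡m a≤b))
... | inj₂ b≤a = reverseʷ (ascentʷ xs (toℕ a ∸ toℕ b) b a (sym (m∸n+n≡m b≤a)))

length-segmentʷ : {ns : Vec ℕ d} (xs : Vertex ns) (a b : Fin n) →
                  walkLength (n ∷ ns) (segmentʷ xs a b) ≡ ∣ toℕ a - toℕ b ∣
length-segmentʷ xs a b with ≤-total (toℕ a) (toℕ b)
... | inj₁ a≤b = trans (length-ascentʷ xs _ a b _) (sym (m≤n⇒∣m-n∣≡n∸m a≤b))
... | inj₂ b≤a = begin
  walkLength _ (reverseʷ (ascentʷ xs (toℕ a ∸ toℕ b) b a _)) ≡⟨ length-reverseʷ _ ⟩
  walkLength _ (ascentʷ xs (toℕ a ∸ toℕ b) b a _)            ≡⟨ length-ascentʷ xs _ b a _ ⟩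
  toℕ a ∸ toℕ b                                             ≡⟨ m≤n⇒∣m-n∣≡n∸m b≤a ⟨
  ∣ toℕ b - toℕ a ∣                                         ≡⟨ ∣-∣-comm (toℕ b) (toℕ a) ⟩
  ∣ toℕ a - toℕ b ∣                                         ∎
  where open ≡-Reasoning

geodesic : {ns : Vec ℕ d} (x y : Vertex ns) → Walk ns x y
geodesic {ns = []} x _ = stop x
geodesic {ns = _ ∷ _} (a , xs) (b , ys) = segmentʷ xs a b ++ʷ liftʷ b (geodesic xs ys)

length-geodesic : {ns : Vec ℕ d} (x y : Vertex ns) → walkLength ns (geodesic x y) ≡ dist x y
length-geodesic {ns = []} _ _ = refl
length-geodesic {ns = _ ∷ _} (a , xs) (b , ys) = begin
  walkLength _ (segmentʷ xs a b ++ʷ liftʷ b (geodesic xs ys))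
    ≡⟨ length-++ʷ (segmentʷ xs a b) _ ⟩
  walkLength _ (segmentʷ xs a b) + walkLength _ (liftʷ b (geodesic xs ys))
    ≡⟨ cong₂ _+_ (length-segmentʷ xs a b) (length-liftʷ b _) ⟩
  ∣ toℕ a - toℕ b ∣ + walkLength _ (geodesic xs ys)
    ≡⟨ cong (∣ toℕ a - toℕ b ∣ +_) (length-geodesic xs ys) ⟩
  ∣ toℕ a - toℕ b ∣ + dist xs ys ∎
  where open ≡-Reasoning

shortest⇒length≤dist : {ns : Vec ℕ d} {x y : Vertex ns} {w : Walk ns x y} →
                       Shortest ns w → walkLength ns w ≤ dist x y
shortest⇒length≤dist {x = x} {y} shortest =
  ≤-trans (shortest (geodesic x y)) (≤-reflexive (length-geodesic x y))

convex⇒between : {ns : Vec ℕ d} {C : Vertex ns → Set} → Convex ns C → {x y z : Vertex ns} →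
                 C x → C y → dist x z + dist z y ≡ dist x y → C z
convex⇒between convex {x} {y} {z} Cx Cy between =
  convex x y Cx Cy w shortest z (onWalk-++ʷ (geodesic x z) (geodesic z y))
  where
  w : Walk _ x y
  w = geodesic x z ++ʷ geodesic z y
  shortest : Shortest _ w
  shortest w′ = begin
    walkLength _ w
      ≡⟨ length-++ʷ (geodesic x z) (geodesic z y) ⟩
    walkLength _ (geodesic x z) + walkLength _ (geodesic z y)
      ≡⟨ cong₂ _+_ (length-geodesic x z) (length-geodesic z y) ⟩
    dist x z + dist z y
      ≡⟨ between ⟩
    dist x y
      ≤⟨ dist≤length w′ ⟩
    walkLength _ w′ ∎
    where open ≤-Reasoning

-- Facets and the convex hull

coord : {ns : Vec ℕ d} → Vertex ns → (i : Fin d) → Fin (lookup ns i)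
coord {ns = _ ∷ _} (a , _) zero = a
coord {ns = _ ∷ _} (_ , xs) (suc i) = coord xs i

_[_]≔_ : {ns : Vec ℕ d} → Vertex ns → (i : Fin d) → Fin (lookup ns i) → Vertex ns
_[_]≔_ {ns = _ ∷ _} (_ , xs) zero a = (a , xs)
_[_]≔_ {ns = _ ∷ _} (b , xs) (suc i) a = (b , xs [ i ]≔ a)

dist-≔-≔ : {ns : Vec ℕ d} (p : Vertex ns) (i : Fin d) (a b : Fin (lookup ns i)) →
           dist (p [ i ]≔ a) (p [ i ]≔ b) ≡ ∣ toℕ a - toℕ b ∣
dist-≔-≔ {ns = _ ∷ _} (_ , xs) zero a b =
  trans (cong (∣ toℕ a - toℕ b ∣ +_) (dist-self xs)) (+-identityʳ _)
dist-≔-≔ {ns = _ ∷ _} (c , xs) (suc i) a b =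
  trans (cong (_+ dist (xs [ i ]≔ a) (xs [ i ]≔ b)) (∣n-n∣≡0 (toℕ c))) (dist-≔-≔ xs i a b)

dist-≔-between : {ns : Vec ℕ d} (p : Vertex ns) (i : Fin d) (u : Vertex ns) →
                 dist p (p [ i ]≔ coord u i) + dist (p [ i ]≔ coord u i) u ≡ dist p u
dist-≔-between {ns = _ ∷ _} (a , ps) zero (b , us)
  rewrite dist-self ps | ∣n-n∣≡0 (toℕ b) = cong (_+ dist ps us) (+-identityʳ _)
dist-≔-between {ns = _ ∷ _} (a , ps) (suc i) (b , us) rewrite ∣n-n∣≡0 (toℕ a) = begin
  dist ps q + (∣ toℕ a - toℕ b ∣ + dist q us)
    ≡⟨ x∙yz≈y∙xz (dist ps q) ∣ toℕ a - toℕ b ∣ (dist q us) ⟩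
  ∣ toℕ a - toℕ b ∣ + (dist ps q + dist q us)
    ≡⟨ cong (∣ toℕ a - toℕ b ∣ +_) (dist-≔-between ps i us) ⟩
  ∣ toℕ a - toℕ b ∣ + dist ps us ∎
  where
  open ≡-Reasoning
  q : Vertex _
  q = ps [ i ]≔ coord us i

End : Bool → Fin n → Set
End false a = toℕ a ≡ 0
End {n} true a = suc (toℕ a) ≡ n

Facet : {ns : Vec ℕ d} → Fin d → Bool → Vertex ns → Set
Facet i s x = End s (coord x i)

End-true⇒max : {a : Fin n} → End true a → (c : Fin n) → toℕ c ≤ toℕ a
End-true⇒max 1+a≡n c = ≤-pred (≤-trans (toℕ<n c) (≤-reflexive (sym 1+a≡n)))

End-between : {a b : Fin n} → End false a → End true b → (c : Fin n) →
              ∣ toℕ a - toℕ c ∣ + ∣ toℕ c - toℕ b ∣ ≡ ∣ toℕ a - toℕ b ∣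
End-between {b = b} a≡0 b-max c rewrite a≡0 = begin
  toℕ c + ∣ toℕ c - toℕ b ∣ ≡⟨ cong (toℕ c +_) (m≤n⇒∣m-n∣≡n∸m c≤b) ⟩
  toℕ c + (toℕ b ∸ toℕ c)   ≡⟨ m+[n∸m]≡n c≤b ⟩
  toℕ b                     ∎
  where
  open ≡-Reasoning
  c≤b : toℕ c ≤ toℕ b
  c≤b = End-true⇒max b-max c

MeetsEveryFacet : {ns : Vec ℕ d} → (Vertex ns → Set) → Set
MeetsEveryFacet {d = d} {ns} S = (i : Fin d) (s : Bool) → Σ (Vertex ns) λ u → S u × Facet i s u

ClosedUnder≔ : {ns : Vec ℕ d} → (Vertex ns → Set) → Set
ClosedUnder≔ {d = d} {ns} C = {p : Vertex ns} (i : Fin d) (a : Fin (lookup ns i)) → C p → C (p [ i ]≔ a)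

closedUnder≔⇒full : {ns : Vec ℕ d} {C : Vertex ns → Set} → ClosedUnder≔ C →
                    (p : Vertex ns) → C p → (t : Vertex ns) → C t
closedUnder≔⇒full {ns = []} _ _ Cp _ = Cp
closedUnder≔⇒full {ns = _ ∷ _} {C} closed (_ , ps) Cp (t , ts) =
  closedUnder≔⇒full {C = λ xs → C (t , xs)} (λ i a → closed (suc i) a) ps (closed zero t Cp) ts

-- p [ i ]≔ a lies between the points p [ i ]≔ 0 and p [ i ]≔ n_i − 1, and these lie between p
-- and vertices of S on the two facets orthogonal to the i-th axis.
convex⇒closedUnder≔ : {ns : Vec ℕ d} {S C : Vertex ns → Set} → MeetsEveryFacet S →
                      Convex ns C → (∀ u → S u → C u) → ClosedUnder≔ C
convex⇒closedUnder≔ {C = C} meets convex S⊆C {p} i a Cp =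
  convex⇒between convex (C-towards false) (C-towards true) between
  where
  end : Bool → Fin _
  end s = coord (proj₁ (meets i s)) i
  C-towards : (s : Bool) → C (p [ i ]≔ end s)
  C-towards s =
    convex⇒between convex Cp (S⊆C _ (proj₁ (proj₂ (meets i s)))) (dist-≔-between p i (proj₁ (meets i s)))
  between : dist (p [ i ]≔ end false) (p [ i ]≔ a) + dist (p [ i ]≔ a) (p [ i ]≔ end true)
          ≡ dist (p [ i ]≔ end false) (p [ i ]≔ end true)
  between rewrite dist-≔-≔ p i (end false) a | dist-≔-≔ p i a (end true)
                | dist-≔-≔ p i (end false) (end true) =
    End-between (proj₂ (proj₂ (meets i false))) (proj₂ (proj₂ (meets i true))) a

meetsEveryFacet⇒inHull : {ns : Vec ℕ (suc d)} {S : Vertex ns → Set} → MeetsEveryFacet S →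
                         (v : Vertex ns) → InHull ns S v
meetsEveryFacet⇒inHull meets v C convex S⊆C with meets zero false
... | u , Su , _ = closedUnder≔⇒full (convex⇒closedUnder≔ meets convex S⊆C) u (S⊆C u Su) v

∣m-n∣≤m+n : ∀ m n → ∣ m - n ∣ ≤ m + n
∣m-n∣≤m+n m n = ≤-trans (∣m-n∣≤m⊔n m n) (m⊔n≤m+n m n)

detour-below : ∀ {x y} → x ≢ 0 → y ≢ 0 → 2 + ∣ x - y ∣ ≤ x + y
detour-below {zero} x≢0 _ = ⊥-elim (x≢0 refl)
detour-below {suc _} {zero} _ y≢0 = ⊥-elim (y≢0 refl)
detour-below {suc x} {suc y} _ _ = s≤s (≤-trans (s≤s (∣m-n∣≤m+n x y)) (≤-reflexive (sym (+-suc x y))))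

detour-above : ∀ {x y z} → x < z → y < z → 2 + ∣ x - y ∣ ≤ ∣ x - z ∣ + ∣ z - y ∣
detour-above {suc x} {suc y} {suc z} (s≤s x<z) (s≤s y<z) = detour-above x<z y<z
detour-above {zero} {y} {z} _ y<z rewrite ∣-∣-comm z y | m≤n⇒∣m-n∣≡n∸m (<⇒≤ y<z) =
  ≤-trans (≤-reflexive (trans (+-comm 2 y) (+-suc y 1))) (+-mono-≤ y<z (m<n⇒0<n∸m y<z))
detour-above {suc x} {zero} {z} x<z _ rewrite m≤n⇒∣m-n∣≡n∸m (<⇒≤ x<z) | ∣-∣-identityʳ z =
  +-mono-≤ (m<n⇒0<n∸m x<z) x<z

End-detour : {a b c : Fin n} (s : Bool) → ¬ End s a → ¬ End s b → End s c →
             2 + ∣ toℕ a - toℕ b ∣ ≤ ∣ toℕ a - toℕ c ∣ + ∣ toℕ c - toℕ b ∣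
End-detour {a = a} false a≢0 b≢0 c≡0 rewrite c≡0 | ∣-∣-identityʳ (toℕ a) = detour-below a≢0 b≢0
End-detour {c = c} true ¬a-max ¬b-max c-max = detour-above (below-max ¬a-max) (below-max ¬b-max)
  where
  below-max : {x : Fin _} → ¬ End true x → toℕ x < toℕ c
  below-max {x} ¬x-max = ≤∧≢⇒< (End-true⇒max c-max x) (λ x≡c → ¬x-max (trans (cong suc x≡c) c-max))

facet-detour : {ns : Vec ℕ d} (i : Fin d) (s : Bool) {x y z : Vertex ns} →
               ¬ Facet i s x → ¬ Facet i s y → Facet i s z → 2 + dist x y ≤ dist x z + dist z y
facet-detour {ns = _ ∷ _} zero s {a , xs} {b , ys} {c , zs} ¬Fx ¬Fy Fz = begin
  2 + (∣ toℕ a - toℕ b ∣ + dist xs ys)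
    ≤⟨ +-mono-≤ (End-detour s ¬Fx ¬Fy Fz) (dist-triangle xs zs ys) ⟩
  (∣ toℕ a - toℕ c ∣ + ∣ toℕ c - toℕ b ∣) + (dist xs zs + dist zs ys)
    ≡⟨ interchange ∣ toℕ a - toℕ c ∣ _ _ _ ⟩
  (∣ toℕ a - toℕ c ∣ + dist xs zs) + (∣ toℕ c - toℕ b ∣ + dist zs ys) ∎
  where open ≤-Reasoning
facet-detour {ns = _ ∷ _} (suc i) s {a , xs} {b , ys} {c , zs} ¬Fx ¬Fy Fz = begin
  2 + (∣ toℕ a - toℕ b ∣ + dist xs ys)
    ≡⟨ x∙yz≈y∙xz 2 ∣ toℕ a - toℕ b ∣ (dist xs ys) ⟩
  ∣ toℕ a - toℕ b ∣ + (2 + dist xs ys)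
    ≤⟨ +-mono-≤ (∣-∣-triangle (toℕ a) (toℕ c) (toℕ b))
                (facet-detour i s {xs} {ys} {zs} ¬Fx ¬Fy Fz) ⟩
  (∣ toℕ a - toℕ c ∣ + ∣ toℕ c - toℕ b ∣) + (dist xs zs + dist zs ys)
    ≡⟨ interchange ∣ toℕ a - toℕ c ∣ _ _ _ ⟩
  (∣ toℕ a - toℕ c ∣ + dist xs zs) + (∣ toℕ c - toℕ b ∣ + dist zs ys) ∎
  where open ≤-Reasoning

facetᶜ-convex : {ns : Vec ℕ d} (i : Fin d) (s : Bool) → Convex ns (λ u → ¬ Facet i s u)
facetᶜ-convex {ns = ns} i s x y ¬Fx ¬Fy w shortest z z∈w Fz = n≮n (dist x y) (begin-strict
  dist x y              <⟨ n<1+n (dist x y) ⟩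
  1 + dist x y          <⟨ facet-detour {ns = ns} i s ¬Fx ¬Fy Fz ⟩
  dist x z + dist z y   ≤⟨ onWalk⇒dist≤length z∈w ⟩
  walkLength _ w        ≤⟨ shortest⇒length≤dist shortest ⟩
  dist x y              ∎)
  where open ≤-Reasoning

endpoint : {m : ℕ} → Bool → Fin (suc m)
endpoint false = zero
endpoint {m} true = fromℕ m

End-endpoint : {m : ℕ} (s : Bool) → End s (endpoint {m} s)
End-endpoint false = refl
End-endpoint {m} true = cong suc (toℕ-fromℕ m)

origin : {ns : Vec ℕ d} → All (1 ≤_) ns → Vertex ns
origin [] = tt
origin (s≤s _ ∷ nonempty) = zero , origin nonempty

facetVertex : {ns : Vec ℕ d} → All (1 ≤_) ns → (i : Fin d) (s : Bool) → Σ (Vertex ns) (Facet i s)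
facetVertex (s≤s _ ∷ nonempty) zero s = (endpoint s , origin nonempty) , End-endpoint s
facetVertex (s≤s _ ∷ nonempty) (suc i) s with facetVertex nonempty i s
... | xs , Fxs = (zero , xs) , Fxs

End? : (s : Bool) (a : Fin n) → Dec (End s a)
End? false a = toℕ a ≟ 0
End? {n} true a = suc (toℕ a) ≟ n

Facet? : {ns : Vec ℕ d} (i : Fin d) (s : Bool) → Decidable (Facet {ns = ns} i s)
Facet? i s x = End? s (coord x i)

vertices : (ns : Vec ℕ d) → List (Vertex ns)
vertices [] = tt ∷ []
vertices (n ∷ ns) = cartesianProduct (allFin n) (vertices ns)

∈-vertices : {ns : Vec ℕ d} (x : Vertex ns) → x ∈ vertices ns
∈-vertices {ns = []} _ = here refl
∈-vertices {ns = _ ∷ _} (a , xs) = ∈-cartesianProduct⁺ (∈-allFin a) (∈-vertices xs)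

∃-vertex? : {ns : Vec ℕ d} {Q : Vertex ns → Set} → Decidable Q → Dec (Σ (Vertex ns) Q)
∃-vertex? {ns = ns} Q? = map′ satisfied (λ (u , Qu) → lose (∈-vertices u) Qu) (any? Q? (vertices ns))

inHull⇒meetsEveryFacet : {ns : Vec ℕ d} {S : Vertex ns → Set} → All (1 ≤_) ns → Decidable S →
                         ((v : Vertex ns) → InHull ns S v) → MeetsEveryFacet S
inHull⇒meetsEveryFacet nonempty S? spans i s with ∃-vertex? (λ u → S? u ×-dec Facet? i s u)
... | yes found = found
... | no none with facetVertex nonempty i s
...   | v , Fv =
  ⊥-elim (spans v (λ u → ¬ Facet i s u) (facetᶜ-convex i s) (λ u Su Fu → none (u , Su , Fu)) Fv)

∀-Bool? : {Q : Bool → Set} → Decidable Q → Dec ((s : Bool) → Q s)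
∀-Bool? Q? =
  map′ (λ (Qf , Qt) → λ { false → Qf ; true → Qt }) (λ Q → Q false , Q true) (Q? false ×-dec Q? true)

meetsEveryFacet? : {ns : Vec ℕ d} {S : Vertex ns → Set} → Decidable S → Dec (MeetsEveryFacet S)
meetsEveryFacet? S? = Fin.all? λ i → ∀-Bool? λ s → ∃-vertex? (λ u → S? u ×-dec Facet? i s u)

_≟ᵛ_ : {ns : Vec ℕ d} → DecidableEquality (Vertex ns)
_≟ᵛ_ {ns = []} _ _ = yes refl
_≟ᵛ_ {ns = _ ∷ _} = ≡-dec Fin._≟_ _≟ᵛ_

_∈ᵛ?_ : {ns : Vec ℕ d} (v : Vertex ns) (P : List (Vertex ns)) → Dec (v ∈ P)
v ∈ᵛ? P = any? (v ≟ᵛ_) P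

generating⇒meetsEveryFacet : {ns : Vec ℕ d} → All (1 ≤_) ns → {P : List (Vertex ns)} →
                             Generating ns P → MeetsEveryFacet (_∉ P)
generating⇒meetsEveryFacet nonempty {P} = inHull⇒meetsEveryFacet nonempty (λ u → ¬? (u ∈ᵛ? P))

generating? : {ns : Vec ℕ (suc d)} → All (1 ≤_) ns → (P : List (Vertex ns)) → Dec (Generating ns P)
generating? nonempty P =
  map′ meetsEveryFacet⇒inHull (generating⇒meetsEveryFacet nonempty) (meetsEveryFacet? (λ u → ¬? (u ∈ᵛ? P)))

move? : {ns : Vec ℕ (suc d)} → All (1 ≤_) ns → (P : List (Vertex ns)) (v : Vertex ns) → Dec (Move ns P v)
move? nonempty P v = ¬? (v ∈ᵛ? P) ×-dec generating? nonempty (v ∷ P)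

-- Sprague–Grundy values

1+max∉ : (L : List ℕ) → suc (max 0 L) ∉ L
1+max∉ L 1+max∈L = n≮n (max 0 L) (List.lookup (xs≤max 0 L) 1+max∈L)

mex : (L : List ℕ) → Σ ℕ λ g → g ∉ L × (∀ {k} → k < g → k ∈ L)
mex L with Fin.¬∀⟶∃¬-smallest (2 + max 0 L) (λ i → toℕ i ∈ L) (λ i → any? (toℕ i ≟_) L)
             (λ all∈L → 1+max∉ L (subst (_∈ L) (toℕ-fromℕ _) (all∈L (fromℕ (suc (max 0 L))))))
... | g , g∉L , below∈L = toℕ g , g∉L , λ {k} k<g →
  subst (_∈ L) (trans (Fin.toℕ-inject (fromℕ< k<g)) (toℕ-fromℕ< k<g)) (below∈L (fromℕ< k<g))

module _ {ns : Vec ℕ d} where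

  SG-unique : {P : List (Vertex ns)} {g h : ℕ} → SG ns P g → SG ns P h → g ≡ h
  SG-unique (sg g _ sub₁ notOpt₁ below₁) (sg h _ sub₂ notOpt₂ below₂) with <-cmp g h
  ... | tri≈ _ g≡h _ = g≡h
  ... | tri< g<h _ _ with below₂ g g<h
  ...   | v , m , val≡g = ⊥-elim (notOpt₁ v m (trans (SG-unique (sub₁ v m) (sub₂ v m)) val≡g))
  SG-unique (sg g _ sub₁ notOpt₁ below₁) (sg h _ sub₂ notOpt₂ below₂) | tri> _ _ h<g with below₁ h h<g
  ...   | v , m , val≡h = ⊥-elim (notOpt₂ v m (trans (sym (SG-unique (sub₁ v m) (sub₂ v m))) val≡h))

  SG-≢-option : {P : List (Vertex ns)} {v : Vertex ns} {g h : ℕ} →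
                SG ns P g → Move ns P v → SG ns (v ∷ P) h → g ≢ h
  SG-≢-option {v = v} (sg _ _ sub notOpt _) m SGh g≡h = notOpt v m (trans (SG-unique (sub v m) SGh) (sym g≡h))

  SG-option-below : {P : List (Vertex ns)} {g k : ℕ} → SG ns P g → k < g →
                    Σ (Vertex ns) λ v → Move ns P v × SG ns (v ∷ P) k
  SG-option-below (sg _ _ sub _ below) k<g with below _ k<g
  ... | v , m , val≡k = v , m , subst (SG ns _) val≡k (sub v m)

  unselectedIn : List (Vertex ns) → List (Vertex ns) → ℕ
  unselectedIn P [] = 0
  unselectedIn P (u ∷ L) with u ∈ᵛ? P
  ... | yes _ = unselectedIn P L
  ... | no _ = suc (unselectedIn P L)

  unselectedIn-∷-≤ : (v : Vertex ns) (P L : List (Vertex ns)) → unselectedIn (v ∷ P) L ≤ unselectedIn P L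
  unselectedIn-∷-≤ v P [] = z≤n
  unselectedIn-∷-≤ v P (u ∷ L) with u ∈ᵛ? P | u ∈ᵛ? (v ∷ P)
  ... | yes _ | yes _ = unselectedIn-∷-≤ v P L
  ... | yes u∈P | no u∉v∷P = ⊥-elim (u∉v∷P (there u∈P))
  ... | no _ | yes _ = m≤n⇒m≤1+n (unselectedIn-∷-≤ v P L)
  ... | no _ | no _ = s≤s (unselectedIn-∷-≤ v P L)

  unselectedIn-∷-< : {v : Vertex ns} {P : List (Vertex ns)} (L : List (Vertex ns)) → v ∈ L → v ∉ P →
                     unselectedIn (v ∷ P) L < unselectedIn P L
  unselectedIn-∷-< {v} {P} (u ∷ L) v∈u∷L v∉P with u ∈ᵛ? P | u ∈ᵛ? (v ∷ P)
  ... | yes u∈P | no u∉v∷P = ⊥-elim (u∉v∷P (there u∈P))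
  ... | no _ | yes _ = s≤s (unselectedIn-∷-≤ v P L)
  unselectedIn-∷-< (u ∷ L) (here refl) v∉P | yes u∈P | yes _ = ⊥-elim (v∉P u∈P)
  unselectedIn-∷-< (u ∷ L) (there v∈L) v∉P | yes _ | yes _ = unselectedIn-∷-< L v∈L v∉P
  unselectedIn-∷-< (u ∷ L) (here refl) v∉P | no _ | no u∉v∷P = ⊥-elim (u∉v∷P (here refl))
  unselectedIn-∷-< (u ∷ L) (there v∈L) v∉P | no _ | no _ = s≤s (unselectedIn-∷-< L v∈L v∉P)

  unselected : List (Vertex ns) → ℕ
  unselected P = unselectedIn P (vertices ns)

  unselected-move : {v : Vertex ns} {P : List (Vertex ns)} → Move ns P v → unselected (v ∷ P) < unselected P
  unselected-move {v} (v∉P , _) = unselectedIn-∷-< (vertices ns) (∈-vertices v) v∉P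

module Grundy {ns : Vec ℕ d} (move? : (P : List (Vertex ns)) (v : Vertex ns) → Dec (Move ns P v)) where

  Valuation : List (Vertex ns) → Set₁
  Valuation P = (v : Vertex ns) → Move ns P v → ℕ

  optionValue : {P : List (Vertex ns)} → Valuation P → Vertex ns → ℕ
  optionValue {P} val v with move? P v
  ... | yes m = val v m
  ... | no _ = 0

  optionValue-move : {P : List (Vertex ns)} (val : Valuation P) {v : Vertex ns} → Move ns P v →
                     Σ (Move ns P v) λ m → optionValue val v ≡ val v m
  optionValue-move {P} val {v} m with move? P v
  ... | yes m′ = m′ , refl
  ... | no ¬m = ⊥-elim (¬m m)

  optionValues : (P : List (Vertex ns)) → Valuation P → List ℕ
  optionValues P val = map (optionValue val) (filter (move? P) (vertices ns))

  SG-exists′ : (P : List (Vertex ns)) → Acc _<_ (unselected P) → Σ ℕ (SG ns P)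
  SG-exists′ P (acc rec) = g , sg g val sub notOpt below
    where
    SG-after : (v : Vertex ns) → Move ns P v → Σ ℕ (SG ns (v ∷ P))
    SG-after v m = SG-exists′ (v ∷ P) (rec (unselected-move m))
    val : Valuation P
    val v m = proj₁ (SG-after v m)
    sub : (v : Vertex ns) (m : Move ns P v) → SG ns (v ∷ P) (val v m)
    sub v m = proj₂ (SG-after v m)
    g : ℕ
    g = proj₁ (mex (optionValues P val))
    notOpt : (v : Vertex ns) (m : Move ns P v) → val v m ≢ g
    notOpt v m val≡g with optionValue-move val m
    ... | m′ , opt≡val = proj₁ (proj₂ (mex (optionValues P val))) (subst (_∈ optionValues P val) opt≡g
                           (∈-map⁺ (optionValue val) (∈-filter⁺ (move? P) (∈-vertices v) m)))
      where
      opt≡g : optionValue val v ≡ g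
      opt≡g = trans opt≡val (trans (SG-unique (sub v m′) (sub v m)) val≡g)
    below : (k : ℕ) → k < g → Σ (Vertex ns) λ v → Σ (Move ns P v) λ m → val v m ≡ k
    below k k<g with ∈-map∘filter⁻ (optionValue val) (move? P) {xs = vertices ns}
                                   (proj₂ (proj₂ (mex (optionValues P val))) k<g)
    ... | v , _ , k≡opt , m with optionValue-move val m
    ...   | m′ , opt≡val = v , m′ , sym (trans k≡opt opt≡val)

  SG-exists : (P : List (Vertex ns)) → Σ ℕ (SG ns P)
  SG-exists P = SG-exists′ P (<-wellFounded (unselected P))

  SG-zero : {P : List (Vertex ns)} → (∀ {v} → Move ns P v → ¬ SG ns (v ∷ P) 0) → SG ns P 0
  SG-zero {P} noZeroOption = fromValue (SG-exists P)
    where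
    fromValue : Σ ℕ (SG ns P) → SG ns P 0
    fromValue (zero , SG₀) = SG₀
    fromValue (suc _ , SG₁₊) with SG-option-below SG₁₊ (s≤s z≤n)
    ... | _ , m , SGv₀ = ⊥-elim (noZeroOption m SGv₀)

  SG-one : {P : List (Vertex ns)} {c : Vertex ns} → Move ns P c → SG ns (c ∷ P) 0 →
           (∀ {v} → Move ns P v → ¬ SG ns (v ∷ P) 1) → SG ns P 1
  SG-one {P} mc SGc₀ noOneOption = fromValue (SG-exists P)
    where
    fromValue : Σ ℕ (SG ns P) → SG ns P 1
    fromValue (zero , SG₀) = ⊥-elim (SG-≢-option SG₀ mc SGc₀ refl)
    fromValue (suc zero , SG₁) = SG₁
    fromValue (suc (suc _) , SG₂₊) with SG-option-below SG₂₊ (s≤s (s≤s z≤n))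
    ... | _ , m , SGv₁ = ⊥-elim (noOneOption m SGv₁)

-- The central symmetry

σ : {ns : Vec ℕ d} → Vertex ns → Vertex ns
σ {ns = []} x = x
σ {ns = _ ∷ _} (a , xs) = opposite a , σ xs

σ-involutive : {ns : Vec ℕ d} (x : Vertex ns) → σ (σ x) ≡ x
σ-involutive {ns = []} _ = refl
σ-involutive {ns = _ ∷ _} (a , xs) = cong₂ _,_ (Fin.opposite-involutive a) (σ-involutive xs)

σ-injective : {ns : Vec ℕ d} {x y : Vertex ns} → σ x ≡ σ y → x ≡ y
σ-injective {x = x} {y} σx≡σy = trans (sym (σ-involutive x)) (trans (cong σ σx≡σy) (σ-involutive y))

End-opposite : (s : Bool) {a : Fin n} → End (not s) a → End s (opposite a)
End-opposite {n} false {a} 1+a≡n = trans (Fin.opposite-prop a) (trans (cong (n ∸_) 1+a≡n) (n∸n≡0 n))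
End-opposite {suc m} true {a} a≡0 = cong suc (trans (Fin.opposite-prop a) (cong (m ∸_) a≡0))

σ-facet : {ns : Vec ℕ d} (i : Fin d) (s : Bool) {x : Vertex ns} → Facet i (not s) x → Facet i s (σ x)
σ-facet {ns = _ ∷ _} zero s = End-opposite s
σ-facet {ns = _ ∷ _} (suc i) s {_ , xs} = σ-facet i s {xs}

End-disjoint : 2 ≤ n → (s : Bool) {a : Fin n} → End s a → ¬ End (not s) a
End-disjoint 2≤n false a≡0 1+a≡n = n≮n 1 (subst (2 ≤_) (trans (sym 1+a≡n) (cong suc a≡0)) 2≤n)
End-disjoint 2≤n true 1+a≡n a≡0 = n≮n 1 (subst (2 ≤_) (trans (sym 1+a≡n) (cong suc a≡0)) 2≤n)

facet-disjoint : {ns : Vec ℕ d} → All (2 ≤_) ns → (i : Fin d) (s : Bool) {x : Vertex ns} →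
                 Facet i s x → ¬ Facet i (not s) x
facet-disjoint (2≤n ∷ _) zero s = End-disjoint 2≤n s
facet-disjoint (_ ∷ big) (suc i) s {_ , xs} = facet-disjoint big i s {xs}

m*2≡m+m : ∀ m → m * 2 ≡ m + m
m*2≡m+m m = trans (*-comm m 2) (cong (m +_) (+-identityʳ m))

opposite-fixed⇒midpoint : {a : Fin n} → opposite a ≡ a → n ≡ suc (toℕ a * 2)
opposite-fixed⇒midpoint {n} {a} fixed = begin
  n                                 ≡⟨ m∸n+n≡m (toℕ<n a) ⟨
  (n ∸ suc (toℕ a)) + suc (toℕ a)   ≡⟨ cong (_+ suc (toℕ a)) a≡n∸1+a ⟨
  toℕ a + suc (toℕ a)               ≡⟨ +-suc (toℕ a) (toℕ a) ⟩
  suc (toℕ a + toℕ a)               ≡⟨ cong suc (m*2≡m+m (toℕ a)) ⟨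
  suc (toℕ a * 2)                   ∎
  where
  open ≡-Reasoning
  a≡n∸1+a : toℕ a ≡ n ∸ suc (toℕ a)
  a≡n∸1+a = trans (cong toℕ (sym fixed)) (Fin.opposite-prop a)

midpoint⇒opposite-fixed : {a : Fin n} → n ≡ suc (toℕ a * 2) → opposite a ≡ a
midpoint⇒opposite-fixed {n} {a} n≡1+2a = toℕ-injective (begin
  toℕ (opposite a)                  ≡⟨ Fin.opposite-prop a ⟩
  n ∸ suc (toℕ a)                   ≡⟨ cong (_∸ suc (toℕ a)) n≡1+2a ⟩
  toℕ a * 2 ∸ toℕ a                 ≡⟨ cong (_∸ toℕ a) (m*2≡m+m (toℕ a)) ⟩
  toℕ a + toℕ a ∸ toℕ a             ≡⟨ m+n∸m≡n (toℕ a) (toℕ a) ⟩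
  toℕ a                             ∎)
  where open ≡-Reasoning

midpoint-interior : 2 ≤ n → {a : Fin n} → opposite a ≡ a → (s : Bool) → ¬ End s a
midpoint-interior 2≤n fixed false a≡0 =
  n≮n 1 (subst (2 ≤_) (trans (opposite-fixed⇒midpoint fixed) (cong (λ t → suc (t * 2)) a≡0)) 2≤n)
midpoint-interior 2≤n fixed true a-max =
  midpoint-interior 2≤n fixed false (subst (End false) fixed (End-opposite false a-max))

σ-fixed-unique : {ns : Vec ℕ d} {x y : Vertex ns} → σ x ≡ x → σ y ≡ y → x ≡ y
σ-fixed-unique {ns = []} _ _ = refl
σ-fixed-unique {ns = _ ∷ _} {a , _} {b , _} σx≡x σy≡y =
  cong₂ _,_ a≡b (σ-fixed-unique (cong proj₂ σx≡x) (cong proj₂ σy≡y))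
  where
  a≡b : a ≡ b
  a≡b = toℕ-injective (*-cancelʳ-≡ (toℕ a) (toℕ b) 2 (suc-injective
          (trans (sym (opposite-fixed⇒midpoint (cong proj₁ σx≡x)))
                 (opposite-fixed⇒midpoint (cong proj₁ σy≡y)))))

σ-fixed-interior : {ns : Vec ℕ d} → All (2 ≤_) ns → {x : Vertex ns} → σ x ≡ x →
                   (i : Fin d) (s : Bool) → ¬ Facet i s x
σ-fixed-interior (2≤n ∷ _) σx≡x zero = midpoint-interior 2≤n (cong proj₁ σx≡x)
σ-fixed-interior (_ ∷ big) σx≡x (suc i) = σ-fixed-interior big (cong proj₂ σx≡x) i

parity : ∀ m → m % 2 ≡ 0 ⊎ m % 2 ≡ 1
parity m with m % 2 | m%n<n m 2
... | 0 | _ = inj₁ refl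
... | 1 | _ = inj₂ refl
... | suc (suc _) | s≤s (s≤s ())

*-odd : ∀ m n → m % 2 ≡ 1 → n % 2 ≡ 1 → (m * n) % 2 ≡ 1
*-odd m n m-odd n-odd = trans (%-distribˡ-* m n 2) (cong₂ (λ x y → (x * y) % 2) m-odd n-odd)

odd-factorˡ : ∀ m n → (m * n) % 2 ≡ 1 → m % 2 ≡ 1
odd-factorˡ m n mn-odd with parity m
... | inj₂ m-odd = m-odd
... | inj₁ m-even = ⊥-elim (0≢1+n (trans (cong (λ x → (x * (n % 2)) % 2) (sym m-even))
                                      (trans (sym (%-distribˡ-* m n 2)) mn-odd)))

odd-factorʳ : ∀ m n → (m * n) % 2 ≡ 1 → n % 2 ≡ 1
odd-factorʳ m n mn-odd = odd-factorˡ n m (trans (cong (_% 2) (*-comm n m)) mn-odd)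

σ-fixed⇒prod-odd : {ns : Vec ℕ d} {x : Vertex ns} → σ x ≡ x → prod ns % 2 ≡ 1
σ-fixed⇒prod-odd {ns = []} _ = refl
σ-fixed⇒prod-odd {ns = n ∷ ns} {a , _} σx≡x =
  *-odd n (prod ns) n-odd (σ-fixed⇒prod-odd (cong proj₂ σx≡x))
  where
  n-odd : n % 2 ≡ 1
  n-odd = trans (cong (_% 2) (opposite-fixed⇒midpoint (cong proj₁ σx≡x))) ([m+kn]%n≡m%n 1 (toℕ a) 2)

prod-odd⇒σ-fixed : {ns : Vec ℕ d} → prod ns % 2 ≡ 1 → Σ (Vertex ns) λ x → σ x ≡ x
prod-odd⇒σ-fixed {ns = []} _ = tt , refl
prod-odd⇒σ-fixed {ns = n ∷ ns} prod-odd with prod-odd⇒σ-fixed {ns = ns} (odd-factorʳ n (prod ns) prod-odd)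
... | xs , σxs≡xs = (centre , xs) , cong₂ _,_ (midpoint⇒opposite-fixed n≡1+2c) σxs≡xs
  where
  n≡1+2[n/2] : n ≡ suc ((n / 2) * 2)
  n≡1+2[n/2] = trans (m≡m%n+[m/n]*n n 2) (cong (_+ (n / 2) * 2) (odd-factorˡ n (prod ns) prod-odd))
  n/2<n : n / 2 < n
  n/2<n = ≤-<-trans (m≤m*n (n / 2) 2) (≤-reflexive (sym n≡1+2[n/2]))
  centre : Fin n
  centre = fromℕ< n/2<n
  n≡1+2c : n ≡ suc (toℕ centre * 2)
  n≡1+2c = trans n≡1+2[n/2] (cong (λ t → suc (t * 2)) (sym (toℕ-fromℕ< n/2<n)))

-- Mirror strategies

Symmetric : {ns : Vec ℕ d} → List (Vertex ns) → Set
Symmetric P = ∀ {u} → u ∈ P → σ u ∈ P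

mirror-symmetric : {ns : Vec ℕ d} {P : List (Vertex ns)} {v : Vertex ns} →
                   Symmetric P → Symmetric (σ v ∷ v ∷ P)
mirror-symmetric {v = v} _ (here refl) = there (here (σ-involutive v))
mirror-symmetric _ (there (here refl)) = here refl
mirror-symmetric symP (there (there u∈P)) = there (there (symP u∈P))

mirror-∉ : {ns : Vec ℕ d} {P : List (Vertex ns)} {v : Vertex ns} →
           Symmetric P → σ v ≢ v → v ∉ P → σ v ∉ v ∷ P
mirror-∉ _ σv≢v _ (here σv≡v) = σv≢v σv≡v
mirror-∉ {P = P} {v} symP _ v∉P (there σv∈P) = v∉P (subst (_∈ P) (σ-involutive v) (symP σv∈P))

module Mirror {ns : Vec ℕ (suc d)} (big : All (2 ≤_) ns) where

  nonempty : All (1 ≤_) ns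
  nonempty = All.map (≤-trans (s≤s z≤n)) big

  open Grundy (move? nonempty)

  initial-generating : Generating ns []
  initial-generating =
    meetsEveryFacet⇒inHull λ i s →
      proj₁ (facetVertex nonempty i s) , (λ ()) , proj₂ (facetVertex nonempty i s)

  -- If the only unselected vertex found on a facet is σ v, then the mirror image of an unselected
  -- vertex on the opposite facet is used instead.
  mirror-meetsEveryFacet : {P : List (Vertex ns)} {v : Vertex ns} → Symmetric P →
                           MeetsEveryFacet (_∉ v ∷ P) → MeetsEveryFacet (_∉ σ v ∷ v ∷ P)
  mirror-meetsEveryFacet {P} {v} symP meets i s with meets i s
  ... | u , u∉v∷P , Fu with u ≟ᵛ σ v
  ...   | no u≢σv = u , (λ { (here u≡σv) → u≢σv u≡σv ; (there u∈v∷P) → u∉v∷P u∈v∷P }) , Fu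
  ...   | yes refl with meets i (not s)
  ...     | w , w∉v∷P , Fw = σ w , σw∉ , σ-facet i s {w} Fw
    where
    σw∉ : σ w ∉ σ v ∷ v ∷ P
    σw∉ (here σw≡σv) = w∉v∷P (here (σ-injective σw≡σv))
    σw∉ (there (here σw≡v)) =
      facet-disjoint big i s Fu (subst (Facet i (not s)) (trans (sym (σ-involutive w)) (cong σ σw≡v)) Fw)
    σw∉ (there (there σw∈P)) = w∉v∷P (there (subst (_∈ P) (σ-involutive w) (symP σw∈P)))

  mirror-move : {P : List (Vertex ns)} {v : Vertex ns} → Symmetric P → σ v ≢ v →
                Move ns P v → Move ns (v ∷ P) (σ v)
  mirror-move symP σv≢v (v∉P , generating) =
    mirror-∉ symP σv≢v v∉P ,
    meetsEveryFacet⇒inHull (mirror-meetsEveryFacet symP (generating⇒meetsEveryFacet nonempty generating))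

  SG-pairing′ : (P : List (Vertex ns)) → Acc _<_ (unselected P) →
                Symmetric P → (∀ {u} → u ∉ P → σ u ≢ u) → SG ns P 0
  SG-pairing′ P (acc rec) symP fixedPointFree = SG-zero noZeroOption
    where
    noZeroOption : ∀ {v} → Move ns P v → ¬ SG ns (v ∷ P) 0
    noZeroOption {v} m SGv₀ = SG-≢-option SGv₀ m′ SG-reply refl
      where
      m′ : Move ns (v ∷ P) (σ v)
      m′ = mirror-move symP (fixedPointFree (proj₁ m)) m
      SG-reply : SG ns (σ v ∷ v ∷ P) 0
      SG-reply = SG-pairing′ (σ v ∷ v ∷ P) (rec (<-trans (unselected-move m′) (unselected-move m)))
                             (mirror-symmetric symP)
                             (λ u∉ → fixedPointFree (λ u∈P → u∉ (there (there u∈P))))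

  SG-pairing : {P : List (Vertex ns)} → Symmetric P → (∀ {u} → u ∉ P → σ u ≢ u) → SG ns P 0
  SG-pairing {P} = SG-pairing′ P (<-wellFounded (unselected P))

  module _ {c : Vertex ns} (σc≡c : σ c ≡ c) where

    centre-move : {P : List (Vertex ns)} → Generating ns P → c ∉ P → Move ns P c
    centre-move {P} generating c∉P = c∉P , meetsEveryFacet⇒inHull meets
      where
      meets : MeetsEveryFacet (_∉ c ∷ P)
      meets i s with generating⇒meetsEveryFacet nonempty generating i s
      ... | u , u∉P , Fu =
        u , (λ { (here refl) → σ-fixed-interior big σc≡c i s Fu ; (there u∈P) → u∉P u∈P }) , Fu

    SG-after-centre : {P : List (Vertex ns)} → Symmetric P → SG ns (c ∷ P) 0
    SG-after-centre symP = SG-pairing (λ { (here refl) → here σc≡c ; (there u∈P) → there (symP u∈P) })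
                                      (λ u∉c∷P σu≡u → u∉c∷P (here (σ-fixed-unique σu≡u σc≡c)))

    SG-centre′ : (P : List (Vertex ns)) → Acc _<_ (unselected P) →
                 Symmetric P → Generating ns P → c ∉ P → SG ns P 1
    SG-centre′ P (acc rec) symP generating c∉P =
      SG-one (centre-move generating c∉P) (SG-after-centre symP) noOneOption
      where
      noOneOption : ∀ {v} → Move ns P v → ¬ SG ns (v ∷ P) 1
      noOneOption {v} m SGv₁ with v ≟ᵛ c
      ... | yes refl = 1+n≢0 (SG-unique SGv₁ (SG-after-centre symP))
      ... | no v≢c = SG-≢-option SGv₁ m′ SG-reply refl
        where
        m′ : Move ns (v ∷ P) (σ v)
        m′ = mirror-move symP (λ σv≡v → v≢c (σ-fixed-unique σv≡v σc≡c)) m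
        c∉ : c ∉ σ v ∷ v ∷ P
        c∉ (here c≡σv) = v≢c (trans (sym (σ-involutive v)) (trans (cong σ (sym c≡σv)) σc≡c))
        c∉ (there (here c≡v)) = v≢c (sym c≡v)
        c∉ (there (there c∈P)) = c∉P c∈P
        SG-reply : SG ns (σ v ∷ v ∷ P) 1
        SG-reply = SG-centre′ (σ v ∷ v ∷ P) (rec (<-trans (unselected-move m′) (unselected-move m)))
                              (mirror-symmetric symP) (proj₂ m′) c∉

    SG-centre : {P : List (Vertex ns)} → Symmetric P → Generating ns P → c ∉ P → SG ns P 1
    SG-centre {P} = SG-centre′ P (<-wellFounded (unselected P))

  nimValue : NimValueDNT ns (prod ns % 2)
  nimValue with parity (prod ns)
  ... | inj₁ even = subst (NimValueDNT ns) (sym even) (SG-pairing (λ ()) σ-fixedPointFree)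
    where
    σ-fixedPointFree : {u : Vertex ns} → u ∉ [] → σ u ≢ u
    σ-fixedPointFree _ σu≡u = 0≢1+n (trans (sym even) (σ-fixed⇒prod-odd σu≡u))
  ... | inj₂ odd with prod-odd⇒σ-fixed odd
  ...   | _ , σc≡c = subst (NimValueDNT ns) (sym odd) (SG-centre σc≡c (λ ()) initial-generating (λ ()))

mainTheorem3 : (d : ℕ) (ns : Vec ℕ (suc d)) →
    2 Data.Nat.≤ head ns →
    ((i j : Fin (suc d)) → i Data.Fin.≤ j → lookup ns i Data.Nat.≤ lookup ns j) →
    3 Data.Nat.≤ last ns →
    NimValueDNT ns (prod ns % 2)
mainTheorem3 _ (_ ∷ _) 2≤head sorted _ =
  Mirror.nimValue (lookup⁻ λ i → ≤-trans 2≤head (sorted zero i z≤n))
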